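{- Let $\sigma\le\tau$ in the consecutive pattern poset $S$, let $n=|\tau|-|\sigma|$, and let $C:\tau=\rho_0\to\rho_1\to\cdots\to\rho_n=\sigma$ be a maximal chain of $[\sigma,\tau]$ with chain id $l_1\ldots l_n$. If $1\le i\le n-1$ and $\rho_i$ is an ascent of $C$ (i.e. $l_i<l_{i+1}$), then $\rho_i$ is not contained in any minimal skipped interval (MSI) of $C$, with respect to the lexicographic order of chain ids on the maximal chains of $[\sigma,\tau]$.
   Context: For $d\ge1$, $S_d$ is the set of permutations of $\{1,\dots,d\}$ in one-line notation, $S=\bigcup_{d>0}S_d$, and $|\tau|=d$ for $\tau\in S_d$. The standard form of a sequence of distinct integers $s(1)\ldots s(k)$ is the permutation in $S_k$ whose entries are in the same relative order. The consecutive pattern poset orders $S$ by $\sigma\le\tau$ ($\sigma\in S_k$, $\tau\in S_d$) iff for some $i$ the standard form of $\tau(i+1)\ldots\tau(i+k)$ equals $\sigma$. A permutation is monotone if its entries are strictly increasing or strictly decreasing. In a maximal chain $\tau=\rho_0\to\cdots\to\rho_n=\sigma$ ($\to$ denotes a cover, $|\rho_i|=|\tau|-i$), the chain id $l_1\ldots l_n$ is defined inductively by windows of positions of $\tau$: $W_0=\{1,\dots,|\tau|\}$; given $W_{i-1}=\{a,\dots,b\}$ with the standard form of $\tau(a)\ldots\tau(b)$ equal to $\rho_{i-1}$: if $\rho_{i-1}$ is not monotone, exactly one of the standard forms of $\tau(a+1)\ldots\tau(b)$ and $\tau(a)\ldots\tau(b-1)$ equals $\rho_i$; in the first case put $l_i=a$,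 $W_i=\{a+1,\dots,b\}$, in the second $l_i=b$, $W_i=\{a,\dots,b-1\}$; if $\rho_{i-1}$ is monotone put $l_i=a$, $W_i=\{a+1,\dots,b\}$. Maximal chains of $[\sigma,\tau]$ are totally ordered by the lexicographic order of their chain ids. For $0\le i<j\le n$, $C(\rho_i,\rho_j)=\{\rho_{i+1},\dots,\rho_{j-1}\}$. A nonempty $C(\rho_i,\rho_j)$ is a skipped interval of $C$ if the set of elements of $C$ not in $C(\rho_i,\rho_j)$ is contained in some maximal chain $C'$ of $[\sigma,\tau]$ lexicographically earlier than $C$; it is a minimal skipped interval (MSI) if it properly contains no other skipped interval of $C$. -}

module Defs where

open import Data.Nat using (ℕ; zero; suc; _+_; _∸_; _≤_; _<_; _<?_)
open import Data.Nat.Properties using (≤-refl)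
open import Data.Bool using (Bool; true; false; if_then_else_; _∨_; _∧_)
open import Data.List using (List; []; _∷_; length; map; filter; take; drop; upTo)
open import Data.List.Properties using (≡-dec)
open import Data.List.Relation.Binary.Permutation.Propositional using (_↭_)
open import Data.Product using (Σ; _×_; ∃; _,_)
open import Relation.Nullary using (¬_; does)
open import Relation.Binary.PropositionalEquality using (_≡_)
import Data.Nat as ℕ

-- Permutations in one-line notation are lists of naturals.
-- A list is a permutation (element of S = ⋃_{d>0} S_d) iff it has
-- length d ≥ 1 and is a rearrangement of 1 … d.
IsPerm : List ℕ → Set
IsPerm xs = (1 ≤ length xs) × (xs ↭ map suc (upTo (length xs)))

std : List ℕ → List ℕ
std xs = map (λ x → suc (length (filter (_<? x) xs))) xs

-- Consecutive pattern order: σ ≼ τ iff σ is the standard form of some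
-- factor τ(i+1) … τ(i+k) (0-based offset i, k = |σ|).
_≼_ : List ℕ → List ℕ → Set
σ ≼ τ = Σ ℕ λ i → (i + length σ ≤ length τ) × (std (take (length σ) (drop i τ)) ≡ σ)

-- Factor τ(a) … τ(b), positions 1-based.
slice : List ℕ → ℕ → ℕ → List ℕ
slice τ a b = take (suc b ∸ a) (drop (a ∸ 1) τ)

incr : List ℕ → Bool
incr [] = true
incr (x ∷ []) = true
incr (x ∷ y ∷ ys) = does (x <? y) ∧ incr (y ∷ ys)

decr : List ℕ → Bool
decr [] = true
decr (x ∷ []) = true
decr (x ∷ y ∷ ys) = does (y <? x) ∧ decr (y ∷ ys)

monotone : List ℕ → Bool
monotone xs = incr xs ∨ decr xs

-- A maximal chain τ = ρ 0 → ρ 1 → … → ρ n = σ of [σ,τ], n = |τ| - |σ|,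
-- given as a function ℕ → List ℕ (only the values at 0 … n matter).
record MaxChain (σ τ : List ℕ) (ρ : ℕ → List ℕ) : Set where
  field
    start : ρ 0 ≡ τ
    end   : ρ (length τ ∸ length σ) ≡ σ
    perm  : ∀ i → i ≤ length τ ∸ length σ → IsPerm (ρ i)
    size  : ∀ i → i ≤ length τ ∸ length σ → length (ρ i) ≡ length τ ∸ i
    cover : ∀ i → i < length τ ∸ length σ → ρ (suc i) ≼ ρ i

-- Chain id l₁ … l_n computed through the windows W_i = {a,…,b}.
chainIdGo : List ℕ → (ℕ → List ℕ) → ℕ → ℕ → ℕ → ℕ → List ℕ
chainIdGo τ ρ a b i zero = []
chainIdGo τ ρ a b i (suc k) =
  if monotone (ρ i)
  then a ∷ chainIdGo τ ρ (suc a) b (suc i) k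
  else (if does (≡-dec ℕ._≟_ (std (slice τ (suc a) b)) (ρ (suc i)))
        then a ∷ chainIdGo τ ρ (suc a) b (suc i) k
        else b ∷ chainIdGo τ ρ a (b ∸ 1) (suc i) k)

chainId : List ℕ → List ℕ → (ℕ → List ℕ) → List ℕ
chainId σ τ ρ = chainIdGo τ ρ 1 (length τ) 0 (length τ ∸ length σ)

-- l-th entry (0-based) of a list, default 0.
nth : List ℕ → ℕ → ℕ
nth [] _ = 0
nth (x ∷ xs) zero = x
nth (x ∷ xs) (suc k) = nth xs k

data LexLt : List ℕ → List ℕ → Set where
  here  : ∀ {x y xs ys} → x < y → LexLt (x ∷ xs) (y ∷ ys)
  there : ∀ {x xs ys} → LexLt xs ys → LexLt (x ∷ xs) (x ∷ ys)

InInterval : (ℕ → List ℕ) → ℕ → ℕ → List ℕ → Set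
InInterval ρ i j x = Σ ℕ λ m → (i < m) × (m < j) × (ρ m ≡ x)

InChain : (ℕ → List ℕ) → ℕ → List ℕ → Set
InChain ρ n x = Σ ℕ λ m → (m ≤ n) × (ρ m ≡ x)

Skipped : List ℕ → List ℕ → (ℕ → List ℕ) → ℕ → ℕ → Set
Skipped σ τ ρ i j =
  (i < j) × (j ≤ length τ ∸ length σ) × (Σ (List ℕ) λ x → InInterval ρ i j x) ×
  (Σ (ℕ → List ℕ) λ ρ′ → MaxChain σ τ ρ′ × LexLt (chainId σ τ ρ′) (chainId σ τ ρ) ×
     (∀ k → k ≤ length τ ∸ length σ → ¬ InInterval ρ i j (ρ k) →
        InChain ρ′ (length τ ∸ length σ) (ρ k)))

MSI : List ℕ → List ℕ → (ℕ → List ℕ) → ℕ → ℕ → Set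
MSI σ τ ρ i j =
  Skipped σ τ ρ i j ×
  (∀ i′ j′ → Skipped σ τ ρ i′ j′ →
     (∀ x → InInterval ρ i′ j′ x → InInterval ρ i j x) →
     ¬ (Σ (List ℕ) λ x → InInterval ρ i j x × ¬ InInterval ρ i′ j′ x))

module Submission where

-- The chain id of C records, for every cover ρ_j → ρ_{j+1}, which end of the current
-- window W_j of positions of τ is removed ("left step": its left end, "right step": its
-- right end).  The window invariant says that W_j is a genuine factor of τ whose standard
-- form is ρ_j.  From it we derive three facts about C (0-based: label j is l_{j+1}):
--   * a right step is followed by a smaller label, so an ascent l_i < l_{i+1} comes after
--     a left step;
--   * a right step followed by a left step can be swapped: replacing ρ_{s+1} by the
--     standard form of W_s without its first entry gives a lexicographically earlier
--     maximal chain that differs from C only at ρ_{s+1};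
--   * an earlier chain that agrees with C up to ρ_p has to follow every left step of C.
-- If an MSI C(ρ_p,ρ_q) contained the ascent ρ_i, the steps p,…,i-1 are either all left,
-- and then C(ρ_i,ρ_q) is already skipped, or they contain a right step followed by a left
-- one, and then C(ρ_p,ρ_i) is skipped.  Both are skipped intervals properly inside the MSI.

open import Defs
open import Data.Nat
open import Data.Nat.Properties
open import Data.Bool using (Bool; true; false; _∧_; _∨_)
open import Data.List using (List; []; _∷_; length; map; filter; take; drop; upTo; applyUpTo)
open import Data.List.Properties
  using (≡-dec; filter-accept; filter-reject; filter-all; filter-none; length-filter; length-map;
         length-take; length-drop; map-∘; map-cong-local; map-upTo; take-map; drop-map; take-take; take-all)
open import Data.List.Membership.Propositional using (_∈_)
open import Data.List.Relation.Unary.Any using (here; there)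
open import Data.List.Relation.Unary.All as All using (All; []; _∷_)
open import Data.List.Relation.Unary.AllPairs using (_∷_)
open import Data.List.Relation.Unary.Unique.Propositional using (Unique)
import Data.List.Relation.Unary.Unique.Propositional.Properties as UniqueProps
open import Data.List.Relation.Binary.Subset.Propositional using (_⊆_)
open import Data.List.Relation.Binary.Sublist.Propositional.Properties using (take-⊆; drop-⊆; Any-resp-⊆)
open import Data.List.Relation.Binary.Permutation.Propositional
  using (_↭_; prep; swap; ↭-trans; ↭-sym; ↭-reflexive; ↭⇒↭ₛ)
open import Data.List.Relation.Binary.Permutation.Propositional.Properties using (map⁺)
import Data.List.Relation.Binary.Permutation.Setoid.Properties as SetoidPermProps
open import Data.Product using (Σ; _×_; _,_; proj₁; proj₂)
open import Data.Sum using (_⊎_; inj₁; inj₂; [_,_]′)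
open import Data.Empty using (⊥)
open import Relation.Nullary using (¬_; yes; no; does; contradiction)
open import Relation.Nullary.Reflects using (ofʸ)
open import Relation.Binary.Definitions using (tri<; tri≈; tri>)
open import Relation.Binary.PropositionalEquality
open import Function using (id; _∘_; _∘′_)

module PermProps = SetoidPermProps (setoid ℕ)

factor : List ℕ → ℕ → ℕ → List ℕ
factor τ o L = take L (drop o τ)

rank : ℕ → List ℕ → ℕ
rank x zs = length (filter (_<? x) zs)

rank-∷-< : ∀ {x z} zs → z < x → rank x (z ∷ zs) ≡ suc (rank x zs)
rank-∷-< {x} zs z<x = cong length (filter-accept (_<? x) z<x)

rank-∷-≮ : ∀ {x z} zs → z ≮ x → rank x (z ∷ zs) ≡ rank x zs
rank-∷-≮ {x} zs z≮x = cong length (filter-reject (_<? x) z≮x)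

rank-mono : ∀ {x y} → x ≤ y → ∀ zs → rank x zs ≤ rank y zs
rank-mono x≤y [] = z≤n
rank-mono {x} {y} x≤y (z ∷ zs) with z <? x | z <? y
... | yes z<x | yes z<y rewrite rank-∷-< {x} zs z<x | rank-∷-< {y} zs z<y = s≤s (rank-mono x≤y zs)
... | yes z<x | no z≮y  = contradiction (<-≤-trans z<x x≤y) z≮y
... | no z≮x  | yes z<y rewrite rank-∷-≮ {x} zs z≮x | rank-∷-< {y} zs z<y = m≤n⇒m≤1+n (rank-mono x≤y zs)
... | no z≮x  | no z≮y  rewrite rank-∷-≮ {x} zs z≮x | rank-∷-≮ {y} zs z≮y = rank-mono x≤y zs

rank-strict : ∀ {x y w zs} → x ≤ y → w ∈ zs → x ≤ w → w < y → rank x zs < rank y zs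
rank-strict {x} {y} {zs = z ∷ zs} x≤y (here refl) x≤w w<y
  rewrite rank-∷-≮ {x} zs (≤⇒≯ x≤w) | rank-∷-< {y} zs w<y = s≤s (rank-mono x≤y zs)
rank-strict {x} {y} {zs = z ∷ zs} x≤y (there w∈zs) x≤w w<y with z <? x | z <? y
... | yes z<x | yes z<y rewrite rank-∷-< {x} zs z<x | rank-∷-< {y} zs z<y = s≤s (rank-strict x≤y w∈zs x≤w w<y)
... | yes z<x | no z≮y  = contradiction (<-≤-trans z<x x≤y) z≮y
... | no z≮x  | yes z<y rewrite rank-∷-≮ {x} zs z≮x | rank-∷-< {y} zs z<y = m≤n⇒m≤1+n (rank-strict x≤y w∈zs x≤w w<y)
... | no z≮x  | no z≮y  rewrite rank-∷-≮ {x} zs z≮x | rank-∷-≮ {y} zs z≮y = rank-strict x≤y w∈zs x≤w w<y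

OrderIsoOn : (ℕ → ℕ) → List ℕ → Set
OrderIsoOn g xs = ∀ {x y} → x ∈ xs → y ∈ xs → (x < y → g x < g y) × (g x < g y → x < y)

rank-map : ∀ {g xs x} → OrderIsoOn g xs → x ∈ xs → ∀ zs → zs ⊆ xs → rank (g x) (map g zs) ≡ rank x zs
rank-map iso x∈xs [] _ = refl
rank-map {g} {xs} {x} iso x∈xs (z ∷ zs) zs⊆xs with z <? x
... | yes z<x rewrite rank-∷-< {x} zs z<x
                    | rank-∷-< {g x} (map g zs) (proj₁ (iso (zs⊆xs (here refl)) x∈xs) z<x)
  = cong suc (rank-map iso x∈xs zs (zs⊆xs ∘ there))
... | no z≮x rewrite rank-∷-≮ {x} zs z≮x
                   | rank-∷-≮ {g x} (map g zs) (z≮x ∘ proj₂ (iso (zs⊆xs (here refl)) x∈xs))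
  = rank-map iso x∈xs zs (zs⊆xs ∘ there)

std-map : ∀ {g xs} → OrderIsoOn g xs → std (map g xs) ≡ std xs
std-map {g} {xs} iso = trans (sym (map-∘ xs))
  (map-cong-local (All.tabulate λ x∈xs → cong suc (rank-map iso x∈xs xs id)))

relRank : List ℕ → ℕ → ℕ
relRank W x = suc (rank x W)

relRank-orderIso : ∀ W → OrderIsoOn (relRank W) W
relRank-orderIso W {x} {y} x∈W y∈W = preserve , reflect
  where
  preserve : x < y → relRank W x < relRank W y
  preserve x<y = s≤s (rank-strict (<⇒≤ x<y) x∈W ≤-refl x<y)
  reflect : relRank W x < relRank W y → x < y
  reflect lt with x <? y
  ... | yes x<y = x<y
  ... | no x≮y = contradiction lt (≤⇒≯ (s≤s (rank-mono (≮⇒≥ x≮y) W)))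

factor-⊆ : ∀ W e L → factor W e L ⊆ W
factor-⊆ W e L = Any-resp-⊆ (drop-⊆ e W) ∘ Any-resp-⊆ (take-⊆ L (drop e W))

std-factor : ∀ W e L → std (factor (std W) e L) ≡ std (factor W e L)
std-factor W e L = begin
  std (take L (drop e (map (relRank W) W)))  ≡⟨ cong (std ∘ take L) (drop-map e W) ⟩
  std (take L (map (relRank W) (drop e W)))  ≡⟨ cong std (take-map L (drop e W)) ⟩
  std (map (relRank W) (factor W e L))       ≡⟨ std-map (λ x∈ y∈ → relRank-orderIso W (factor-⊆ W e L x∈) (factor-⊆ W e L y∈)) ⟩
  std (factor W e L)                         ∎
  where open ≡-Reasoning

ascending : ℕ → List ℕ
ascending zero = []
ascending (suc m) = 1 ∷ map suc (ascending m)

descending : ℕ → List ℕ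
descending zero = []
descending (suc m) = suc m ∷ descending m

∧-mapʳ : ∀ a {b c} → (b ≡ true → c ≡ true) → a ∧ b ≡ true → a ∧ c ≡ true
∧-mapʳ true f e = f e

incr-∷ : ∀ x xs → incr (x ∷ xs) ≡ true → All (x <_) xs × incr xs ≡ true
incr-∷ x [] _ = [] , refl
incr-∷ x (y ∷ ys) e with x <ᵇ y | <ᵇ-reflects-< x y | e
... | true | ofʸ x<y | e′ = x<y ∷ All.map (<-trans x<y) (proj₁ (incr-∷ y ys e′)) , e′
... | false | _ | ()

decr-∷ : ∀ x xs → decr (x ∷ xs) ≡ true → All (_< x) xs × decr xs ≡ true
decr-∷ x [] _ = [] , refl
decr-∷ x (y ∷ ys) e with y <ᵇ x | <ᵇ-reflects-< y x | e
... | true | ofʸ y<x | e′ = y<x ∷ All.map (λ z<y → <-trans z<y y<x) (proj₁ (decr-∷ y ys e′)) , e′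
... | false | _ | ()

incr-take : ∀ k xs → incr xs ≡ true → incr (take k xs) ≡ true
incr-take zero xs e = refl
incr-take (suc k) [] e = refl
incr-take (suc zero) (x ∷ xs) e = refl
incr-take (suc (suc k)) (x ∷ []) e = refl
incr-take (suc (suc k)) (x ∷ y ∷ ys) e = ∧-mapʳ (x <ᵇ y) (incr-take (suc k) (y ∷ ys)) e

decr-take : ∀ k xs → decr xs ≡ true → decr (take k xs) ≡ true
decr-take zero xs e = refl
decr-take (suc k) [] e = refl
decr-take (suc zero) (x ∷ xs) e = refl
decr-take (suc (suc k)) (x ∷ []) e = refl
decr-take (suc (suc k)) (x ∷ y ∷ ys) e = ∧-mapʳ (y <ᵇ x) (decr-take (suc k) (y ∷ ys)) e

rank-above : ∀ x zs → All (x <_) zs → rank x zs ≡ 0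
rank-above x zs above = cong length (filter-none (_<? x) (All.map <⇒≯ above))

rank-below : ∀ x zs → All (_< x) zs → rank x zs ≡ length zs
rank-below x zs below = cong length (filter-all (_<? x) below)

std-incr : ∀ xs → incr xs ≡ true → std xs ≡ ascending (length xs)
std-incr [] _ = refl
std-incr (x ∷ xs) e = cong₂ _∷_ first rest
  where
  above = proj₁ (incr-∷ x xs e)
  first : relRank (x ∷ xs) x ≡ 1
  first rewrite rank-∷-≮ {x} xs (<-irrefl refl) = cong suc (rank-above x xs above)
  rest : map (relRank (x ∷ xs)) xs ≡ map suc (ascending (length xs))
  rest = begin
    map (relRank (x ∷ xs)) xs        ≡⟨ map-cong-local (All.map (λ {y} x<y → cong suc (rank-∷-< {y} xs x<y)) above) ⟩
    map (suc ∘ relRank xs) xs        ≡⟨ map-∘ xs ⟩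
    map suc (std xs)                 ≡⟨ cong (map suc) (std-incr xs (proj₂ (incr-∷ x xs e))) ⟩
    map suc (ascending (length xs))  ∎
    where open ≡-Reasoning

std-decr : ∀ xs → decr xs ≡ true → std xs ≡ descending (length xs)
std-decr [] _ = refl
std-decr (x ∷ xs) e = cong₂ _∷_ first rest
  where
  below = proj₁ (decr-∷ x xs e)
  first : relRank (x ∷ xs) x ≡ suc (length xs)
  first rewrite rank-∷-≮ {x} xs (<-irrefl refl) = cong suc (rank-below x xs below)
  rest : map (relRank (x ∷ xs)) xs ≡ descending (length xs)
  rest = trans (map-cong-local (All.map (λ {y} y<x → cong suc (rank-∷-≮ {y} xs (<-asym y<x))) below))
               (std-decr xs (proj₂ (decr-∷ x xs e)))

length-take-≤ : ∀ k (xs : List ℕ) → k ≤ length xs → length (take k xs) ≡ k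
length-take-≤ k xs k≤ = trans (length-take k xs) (m≤n⇒m⊓n≡m k≤)

-- Removing the first or the last entry of a monotone list gives the same pattern; this
-- is why the chain id treats monotone ρ_{i-1} as a left step.
monotone-shift : ∀ xs → monotone xs ≡ true → std (take (length xs ∸ 1) xs) ≡ std (drop 1 xs)
monotone-shift [] _ = refl
monotone-shift (y ∷ ys) mono with incr (y ∷ ys) in inc
... | true = begin
  std (take L (y ∷ ys))                 ≡⟨ std-incr _ (incr-take L _ inc) ⟩
  ascending (length (take L (y ∷ ys)))  ≡⟨ cong ascending (length-take-≤ L (y ∷ ys) (n≤1+n L)) ⟩
  ascending L                           ≡⟨ std-incr ys (proj₂ (incr-∷ y ys inc)) ⟨
  std ys                                ∎
  where open ≡-Reasoning; L = length ys
... | false = begin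
  std (take L (y ∷ ys))                  ≡⟨ std-decr _ (decr-take L _ mono) ⟩
  descending (length (take L (y ∷ ys)))  ≡⟨ cong descending (length-take-≤ L (y ∷ ys) (n≤1+n L)) ⟩
  descending L                           ≡⟨ std-decr ys (proj₂ (decr-∷ y ys mono)) ⟨
  std ys                                 ∎
  where open ≡-Reasoning; L = length ys

ascending-upTo : ∀ m → ascending m ≡ map suc (upTo m)
ascending-upTo zero = refl
ascending-upTo (suc m) = cong (1 ∷_) (begin
  map suc (ascending m)       ≡⟨ cong (map suc) (ascending-upTo m) ⟩
  map suc (map suc (upTo m))  ≡⟨ cong (map suc) (map-upTo suc m) ⟩
  map suc (applyUpTo suc m)   ∎)
  where open ≡-Reasoning

-- shiftAbove c r = r for r ≤ c and r + 1 for r > c: making room for a new value c + 1.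
shiftAbove : ℕ → ℕ → ℕ
shiftAbove c zero = zero
shiftAbove zero (suc r) = suc (suc r)
shiftAbove (suc c) (suc r) = suc (shiftAbove c r)

shiftAbove-high : ∀ c r → c < r → shiftAbove c r ≡ suc r
shiftAbove-high zero (suc r) _ = refl
shiftAbove-high (suc c) (suc r) (s≤s c<r) = cong suc (shiftAbove-high c r c<r)

shiftAbove-low : ∀ c r → r ≤ c → shiftAbove c r ≡ r
shiftAbove-low c zero _ = refl
shiftAbove-low (suc c) (suc r) (s≤s r≤c) = cong suc (shiftAbove-low c r r≤c)

insert-ascending : ∀ c m → c ≤ m → suc c ∷ map (shiftAbove c) (ascending m) ↭ ascending (suc m)
insert-ascending zero m _ = prep 1 (↭-reflexive (shiftAbove-zero m))
  where
  shiftAbove-zero : ∀ m → map (shiftAbove 0) (ascending m) ≡ map suc (ascending m)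
  shiftAbove-zero zero = refl
  shiftAbove-zero (suc m) = cong (2 ∷_) (trans (sym (map-∘ (ascending m))) (map-∘ (ascending m)))
insert-ascending (suc c) (suc m) (s≤s c≤m) =
  ↭-trans (prep _ (prep 1 (↭-reflexive shifted)))
  (↭-trans (swap (suc (suc c)) 1 (↭-reflexive refl))
           (prep 1 (map⁺ suc (insert-ascending c m c≤m))))
  where
  shifted : map (shiftAbove (suc c)) (map suc (ascending m)) ≡ map suc (map (shiftAbove c) (ascending m))
  shifted = trans (sym (map-∘ (ascending m))) (map-∘ (ascending m))

std-∷ : ∀ x xs → All (x ≢_) xs →
  std (x ∷ xs) ≡ suc (rank x xs) ∷ map (shiftAbove (rank x xs)) (std xs)
std-∷ x xs x∉xs = cong₂ _∷_ (cong suc (rank-∷-≮ {x} xs (<-irrefl refl)))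
  (trans (map-cong-local (All.tabulate relRank-∷)) (map-∘ xs))
  where
  relRank-∷ : ∀ {y} → y ∈ xs → relRank (x ∷ xs) y ≡ shiftAbove (rank x xs) (relRank xs y)
  relRank-∷ {y} y∈xs with <-cmp x y
  ... | tri< x<y _ _ rewrite rank-∷-< {y} xs x<y =
    sym (shiftAbove-high (rank x xs) (relRank xs y) (s≤s (rank-mono (<⇒≤ x<y) xs)))
  ... | tri≈ _ x≡y _ = contradiction x≡y (All.lookup x∉xs y∈xs)
  ... | tri> _ _ y<x rewrite rank-∷-≮ {y} xs (<⇒≯ y<x) =
    sym (shiftAbove-low (rank x xs) (relRank xs y) (rank-strict (<⇒≤ y<x) y∈xs ≤-refl y<x))

std-ascending : ∀ xs → Unique xs → std xs ↭ ascending (length xs)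
std-ascending [] _ = ↭-reflexive refl
std-ascending (x ∷ xs) (x∉xs ∷ unique) rewrite std-∷ x xs x∉xs =
  ↭-trans (prep _ (map⁺ (shiftAbove (rank x xs)) (std-ascending xs unique)))
          (insert-ascending (rank x xs) (length xs) (length-filter (_<? x) xs))

std-isPerm : ∀ xs → Unique xs → 1 ≤ length xs → IsPerm (std xs)
std-isPerm xs unique nonEmpty = subst (1 ≤_) (sym (length-map _ xs)) nonEmpty ,
  ↭-trans (std-ascending xs unique)
          (↭-reflexive (trans (ascending-upTo (length xs)) (cong (map suc ∘ upTo) (sym (length-map _ xs)))))

perm-unique : ∀ xs → IsPerm xs → Unique xs
perm-unique xs (_ , xs↭) =
  PermProps.Unique-resp-↭ (↭⇒↭ₛ (↭-sym xs↭)) (UniqueProps.map⁺ suc-injective (UniqueProps.upTo⁺ (length xs)))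

-- A window {a,…,b} of positions of τ, stored as (a , b).
Window : Set
Window = ℕ × ℕ

leftStep : List ℕ → Window → List ℕ → List ℕ → Bool
leftStep τ (a , b) x y = monotone x ∨ does (≡-dec _≟_ (std (slice τ (suc a) b)) y)

nextWindow : Bool → Window → Window
nextWindow true w = suc (proj₁ w) , proj₂ w
nextWindow false w = proj₁ w , proj₂ w ∸ 1

removed : Bool → Window → ℕ
removed true w = proj₁ w
removed false w = proj₂ w

-- W_j, the kind of the j-th step, and its label l_{j+1}, along an arbitrary sequence ρ.
window : List ℕ → (ℕ → List ℕ) → ℕ → Window
window τ ρ zero = 1 , length τ
window τ ρ (suc j) = nextWindow (leftStep τ (window τ ρ j) (ρ j) (ρ (suc j))) (window τ ρ j)

isLeft : List ℕ → (ℕ → List ℕ) → ℕ → Bool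
isLeft τ ρ j = leftStep τ (window τ ρ j) (ρ j) (ρ (suc j))

label : List ℕ → (ℕ → List ℕ) → ℕ → ℕ
label τ ρ j = removed (isLeft τ ρ j) (window τ ρ j)

labels : List ℕ → (ℕ → List ℕ) → ℕ → ℕ → List ℕ
labels τ ρ j zero = []
labels τ ρ j (suc k) = label τ ρ j ∷ labels τ ρ (suc j) k

isLeft-via : ∀ τ ρ j {w b} → window τ ρ j ≡ w → leftStep τ w (ρ j) (ρ (suc j)) ≡ b → isLeft τ ρ j ≡ b
isLeft-via τ ρ j refl refl = refl

label-via : ∀ τ ρ j {w b} → window τ ρ j ≡ w → leftStep τ w (ρ j) (ρ (suc j)) ≡ b → label τ ρ j ≡ removed b w
label-via τ ρ j refl refl = refl

window-via : ∀ τ ρ j {w b} → window τ ρ j ≡ w → leftStep τ w (ρ j) (ρ (suc j)) ≡ b →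
  window τ ρ (suc j) ≡ nextWindow b w
window-via τ ρ j refl refl = refl

chainIdGo-step : ∀ τ ρ w i k → let b = leftStep τ w (ρ i) (ρ (suc i)) ; w′ = nextWindow b w in
  chainIdGo τ ρ (proj₁ w) (proj₂ w) i (suc k) ≡ removed b w ∷ chainIdGo τ ρ (proj₁ w′) (proj₂ w′) (suc i) k
chainIdGo-step τ ρ (a , b) i k with monotone (ρ i)
... | true = refl
... | false with does (≡-dec _≟_ (std (slice τ (suc a) b)) (ρ (suc i)))
...   | true = refl
...   | false = refl

chainIdGo-labels : ∀ τ ρ k j →
  chainIdGo τ ρ (proj₁ (window τ ρ j)) (proj₂ (window τ ρ j)) j k ≡ labels τ ρ j k
chainIdGo-labels τ ρ zero j = refl
chainIdGo-labels τ ρ (suc k) j =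
  trans (chainIdGo-step τ ρ (window τ ρ j) j k) (cong (label τ ρ j ∷_) (chainIdGo-labels τ ρ k (suc j)))

chainId-labels : ∀ σ τ ρ → chainId σ τ ρ ≡ labels τ ρ 0 (length τ ∸ length σ)
chainId-labels σ τ ρ = chainIdGo-labels τ ρ (length τ ∸ length σ) 0

nth-labels : ∀ τ ρ k j m → m < k → nth (labels τ ρ j k) m ≡ label τ ρ (j + m)
nth-labels τ ρ (suc k) j zero _ = cong (label τ ρ) (sym (+-identityʳ j))
nth-labels τ ρ (suc k) j (suc m) (s≤s m<k) =
  trans (nth-labels τ ρ k (suc j) m m<k) (cong (label τ ρ) (sym (+-suc j m)))

length-labels : ∀ τ ρ k j → length (labels τ ρ j k) ≡ k
length-labels τ ρ zero j = refl
length-labels τ ρ (suc k) j = cong suc (length-labels τ ρ k (suc j))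

AgreeUpTo : ℕ → (ℕ → List ℕ) → (ℕ → List ℕ) → Set
AgreeUpTo D ρ′ ρ = ∀ m → m ≤ D → ρ′ m ≡ ρ m

window-ext : ∀ τ {ρ ρ′ D} → AgreeUpTo D ρ′ ρ → ∀ j → j ≤ D → window τ ρ′ j ≡ window τ ρ j
window-ext τ agree zero _ = refl
window-ext τ agree (suc j) j<D
  rewrite window-ext τ agree j (<⇒≤ j<D) | agree j (<⇒≤ j<D) | agree (suc j) j<D = refl

label-ext : ∀ τ {ρ ρ′ D} → AgreeUpTo D ρ′ ρ → ∀ j → j < D → label τ ρ′ j ≡ label τ ρ j
label-ext τ agree j j<D
  rewrite window-ext τ agree j (<⇒≤ j<D) | agree j (<⇒≤ j<D) | agree (suc j) j<D = refl

labels-ext : ∀ τ {ρ ρ′ D} → AgreeUpTo D ρ′ ρ → ∀ k j → j + k ≤ D → labels τ ρ′ j k ≡ labels τ ρ j k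
labels-ext τ agree zero j _ = refl
labels-ext τ {D = D} agree (suc k) j j+k<D = cong₂ _∷_
  (label-ext τ agree j (<-≤-trans (m<m+n j z<s) j+k<D))
  (labels-ext τ agree k (suc j) (subst (_≤ D) (+-suc j k) j+k<D))

lex-no-reversal : ∀ {xs ys} → LexLt xs ys → ∀ m → (∀ j → j < m → nth xs j ≡ nth ys j) → ¬ nth ys m < nth xs m
lex-no-reversal (here x<y) zero _ y<x = <-asym x<y y<x
lex-no-reversal (here x<y) (suc m) same _ = <-irrefl (same 0 z<s) x<y
lex-no-reversal (there lt) zero _ x<x = <-irrefl refl x<x
lex-no-reversal (there lt) (suc m) same = lex-no-reversal lt m (λ j j<m → same (suc j) (s≤s j<m))

lex-irrefl : ∀ {xs} → ¬ LexLt xs xs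
lex-irrefl (here x<x) = <-irrefl refl x<x
lex-irrefl (there lt) = lex-irrefl lt

lex-first-difference : ∀ xs ys m → (∀ j → j < m → nth xs j ≡ nth ys j) → nth xs m < nth ys m →
  m < length xs → m < length ys → LexLt xs ys
lex-first-difference (x ∷ xs) (y ∷ ys) zero _ x<y _ _ = here x<y
lex-first-difference (x ∷ xs) (y ∷ ys) (suc m) same lt (s≤s m<xs) (s≤s m<ys) with same 0 z<s
... | refl = there (lex-first-difference xs ys m (λ j j<m → same (suc j) (s≤s j<m)) lt m<xs m<ys)

module ChainIds (σ τ : List ℕ) where

  n : ℕ
  n = length τ ∸ length σ

  nth-chainId : ∀ ρ j → j < n → nth (chainId σ τ ρ) j ≡ label τ ρ j
  nth-chainId ρ j j<n = trans (cong (λ l → nth l j) (chainId-labels σ τ ρ)) (nth-labels τ ρ n 0 j j<n)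

  length-chainId : ∀ ρ → length (chainId σ τ ρ) ≡ n
  length-chainId ρ = trans (cong length (chainId-labels σ τ ρ)) (length-labels τ ρ n 0)

  chainId-ext : ∀ {ρ ρ′} → AgreeUpTo n ρ′ ρ → chainId σ τ ρ′ ≡ chainId σ τ ρ
  chainId-ext {ρ} {ρ′} agree = begin
    chainId σ τ ρ′   ≡⟨ chainId-labels σ τ ρ′ ⟩
    labels τ ρ′ 0 n  ≡⟨ labels-ext τ agree n 0 ≤-refl ⟩
    labels τ ρ 0 n   ≡⟨ chainId-labels σ τ ρ ⟨
    chainId σ τ ρ    ∎
    where open ≡-Reasoning

  same-prefix : ∀ {ρ ρ′ m} → m ≤ n → AgreeUpTo m ρ′ ρ →
    ∀ j → j < m → nth (chainId σ τ ρ′) j ≡ nth (chainId σ τ ρ) j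
  same-prefix {ρ} {ρ′} m≤n agree j j<m = begin
    nth (chainId σ τ ρ′) j  ≡⟨ nth-chainId ρ′ j (<-≤-trans j<m m≤n) ⟩
    label τ ρ′ j            ≡⟨ label-ext τ agree j j<m ⟩
    label τ ρ j             ≡⟨ nth-chainId ρ j (<-≤-trans j<m m≤n) ⟨
    nth (chainId σ τ ρ) j   ∎
    where open ≡-Reasoning

  earlier-at : ∀ {ρ ρ′ m} → m < n → AgreeUpTo m ρ′ ρ → label τ ρ′ m < label τ ρ m →
    LexLt (chainId σ τ ρ′) (chainId σ τ ρ)
  earlier-at {ρ} {ρ′} {m} m<n agree lt = lex-first-difference _ _ m (same-prefix (<⇒≤ m<n) agree)
    (subst₂ _<_ (sym (nth-chainId ρ′ m m<n)) (sym (nth-chainId ρ m m<n)) lt)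
    (subst (m <_) (sym (length-chainId ρ′)) m<n) (subst (m <_) (sym (length-chainId ρ)) m<n)

  not-earlier-at : ∀ {ρ ρ′ m} → m < n → AgreeUpTo m ρ′ ρ → label τ ρ m < label τ ρ′ m →
    ¬ LexLt (chainId σ τ ρ′) (chainId σ τ ρ)
  not-earlier-at {ρ} {ρ′} {m} m<n agree lt earlier = lex-no-reversal earlier m (same-prefix (<⇒≤ m<n) agree)
    (subst₂ _<_ (sym (nth-chainId ρ m m<n)) (sym (nth-chainId ρ′ m m<n)) lt)

SameOrder : List ℕ → List ℕ → Set
SameOrder x W = ∀ e L → std (factor x e L) ≡ std (factor W e L)

std-sameOrder : ∀ W → SameOrder (std W) W
std-sameOrder = std-factor

slice-factor : ∀ τ o L → slice τ (suc (suc o)) (o + suc L) ≡ factor τ (suc o) L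
slice-factor τ o L = cong (λ k → take k (drop (suc o) τ)) (trans (cong (_∸ suc o) (+-suc o L)) (m+n∸m≡n o L))

sameOrder-dropFirst : ∀ τ x o L → SameOrder x (factor τ o (suc L)) →
  std (factor x 1 L) ≡ std (factor τ (suc o) L)
sameOrder-dropFirst τ x o L same = trans (same 1 L) (cong std (tail-factor o τ))
  where
  tail-factor : ∀ o xs → factor (factor xs o (suc L)) 1 L ≡ factor xs (suc o) L
  tail-factor zero [] = refl
  tail-factor zero (z ∷ zs) = trans (take-take L L zs) (cong (λ k → take k zs) (⊓-idem L))
  tail-factor (suc o) [] = refl
  tail-factor (suc o) (z ∷ zs) = tail-factor o zs

sameOrder-dropLast : ∀ τ x o L → SameOrder x (factor τ o (suc L)) →
  std (take L x) ≡ std (factor τ o L)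
sameOrder-dropLast τ x o L same = trans (same 0 L)
  (cong std (trans (take-take L (suc L) _) (cong (λ k → take k (drop o τ)) (m≤n⇒m⊓n≡m (n≤1+n L)))))

length-factor : ∀ τ o L → o + L ≤ length τ → length (factor τ o L) ≡ L
length-factor τ o L fits = length-take-≤ L (drop o τ)
  (subst (L ≤_) (sym (length-drop o τ)) (m+n≤o⇒m≤o∸n L (subst (_≤ length τ) (+-comm o L) fits)))

length-std-factor : ∀ τ o L → o + L ≤ length τ → length (std (factor τ o L)) ≡ L
length-std-factor τ o L fits = trans (length-map _ (factor τ o L)) (length-factor τ o L fits)

factor-isPerm : ∀ τ o L → IsPerm τ → o + L ≤ length τ → 1 ≤ L → IsPerm (std (factor τ o L))
factor-isPerm τ o L permτ fits 1≤L = std-isPerm (factor τ o L)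
  (UniqueProps.take⁺ L (UniqueProps.drop⁺ o (perm-unique τ permτ)))
  (subst (1 ≤_) (sym (length-factor τ o L fits)) 1≤L)

-- The two covers used to reroute a chain: dropping the first entry of a pattern of a
-- factor, and passing from a factor to a prefix of it.
dropFirst-≼ : ∀ τ x o L → length x ≡ suc L → o + suc L ≤ length τ → SameOrder x (factor τ o (suc L)) →
  std (factor τ (suc o) L) ≼ x
dropFirst-≼ τ x o L |x| fits same rewrite length-std-factor τ (suc o) L (subst (_≤ length τ) (+-suc o L) fits) =
  1 , ≤-reflexive (sym |x|) , sameOrder-dropFirst τ x o L same

prefix-≼ : ∀ τ o L L′ → L′ ≤ L → o + L ≤ length τ → std (factor τ o L′) ≼ std (factor τ o L)
prefix-≼ τ o L L′ L′≤L fits rewrite length-std-factor τ o L′ (≤-trans (+-monoʳ-≤ o L′≤L) fits) =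
  0 , subst (L′ ≤_) (sym (length-std-factor τ o L fits)) L′≤L ,
  trans (std-factor (factor τ o L) 0 L′)
        (cong std (trans (take-take L′ L (drop o τ)) (cong (λ k → take k (drop o τ)) (m≤n⇒m⊓n≡m L′≤L))))

leftStep-monotone : ∀ τ w x y → monotone x ≡ true → leftStep τ w x y ≡ true
leftStep-monotone τ w x y mono rewrite mono = refl

leftStep-slice : ∀ τ a b x {y} → std (slice τ (suc a) b) ≡ y → leftStep τ (a , b) x y ≡ true
leftStep-slice τ a b x {y} eq with monotone x | ≡-dec _≟_ (std (slice τ (suc a) b)) y
... | true | _ = refl
... | false | yes _ = refl
... | false | no neq = contradiction eq neq

leftStep-right : ∀ τ a b x {y} → monotone x ≡ false → std (slice τ (suc a) b) ≢ y →
  leftStep τ (a , b) x y ≡ false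
leftStep-right τ a b x {y} mono neq rewrite mono with ≡-dec _≟_ (std (slice τ (suc a) b)) y
... | yes eq = contradiction eq neq
... | no _ = refl

data CoverStep (τ x y : List ℕ) (o L : ℕ) : Set where
  leftCover  : leftStep τ (suc o , o + suc L) x y ≡ true → y ≡ std (factor τ (suc o) L) → CoverStep τ x y o L
  rightCover : leftStep τ (suc o , o + suc L) x y ≡ false → y ≡ std (factor τ o L) → CoverStep τ x y o L

-- A cover occurs at offset 0 or 1; offset 1 and the monotone case are left steps, and at
-- offset 0 the step is left exactly when the left-removal gives the same pattern.
classify-cover : ∀ τ x y o L → length x ≡ suc L → length y ≡ L → y ≼ x →
  SameOrder x (factor τ o (suc L)) → CoverStep τ x y o L
classify-cover τ x y o L |x| |y| (e , fits , occ) same =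
  byOffset e (subst₂ (λ k m → e + k ≤ m) |y| |x| fits) (subst (λ k → std (factor x e k) ≡ y) |y| occ)
  where
  asLeft : std (factor τ (suc o) L) ≡ y → CoverStep τ x y o L
  asLeft eq = leftCover (leftStep-slice τ (suc o) (o + suc L) x (trans (cong std (slice-factor τ o L)) eq)) (sym eq)
  byOffset : ∀ e → e + L ≤ suc L → std (factor x e L) ≡ y → CoverStep τ x y o L
  byOffset (suc zero) _ occ = asLeft (trans (sym (sameOrder-dropFirst τ x o L same)) occ)
  byOffset (suc (suc e)) fits _ = contradiction fits (<⇒≱ (s≤s (s≤s (m≤n+m L e))))
  byOffset zero _ occ with monotone x in mono
  ... | true = leftCover (leftStep-monotone τ (suc o , o + suc L) x y mono) (begin
    y                            ≡⟨ occ ⟨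
    std (take L x)               ≡⟨ cong (λ k → std (take k x)) (cong (_∸ 1) |x|) ⟨
    std (take (length x ∸ 1) x)  ≡⟨ monotone-shift x mono ⟩
    std (drop 1 x)               ≡⟨ cong std (take-all L (drop 1 x) (≤-reflexive (trans (length-drop 1 x) (cong (_∸ 1) |x|)))) ⟨
    std (factor x 1 L)           ≡⟨ sameOrder-dropFirst τ x o L same ⟩
    std (factor τ (suc o) L)     ∎)
    where open ≡-Reasoning
  ... | false with ≡-dec _≟_ (std (factor τ (suc o) L)) y
  ...   | yes eq = asLeft eq
  ...   | no neq = rightCover
    (leftStep-right τ (suc o) (o + suc L) x mono (neq ∘′ trans (cong std (sym (slice-factor τ o L)))))
    (trans (sym occ) (sameOrder-dropLast τ x o L same))

module WindowInvariant (σ τ : List ℕ) (ρ : ℕ → List ℕ) (mc : MaxChain σ τ ρ) where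
  open MaxChain mc
  open ChainIds σ τ using (n)

  T : ℕ
  T = length τ

  record WindowAt (j : ℕ) : Set where
    constructor windowData
    field
      offset    : ℕ
      at-window : window τ ρ j ≡ (suc offset , offset + (T ∸ j))
      in-bounds : offset + (T ∸ j) ≤ T
      same      : SameOrder (ρ j) (factor τ offset (T ∸ j))

  record StepAt (j : ℕ) : Set where
    constructor stepData
    field
      o L       : ℕ
      at-window : window τ ρ j ≡ (suc o , o + suc L)
      remaining : T ∸ j ≡ suc L
      in-bounds : o + suc L ≤ T
      same      : SameOrder (ρ j) (factor τ o (suc L))
      step      : CoverStep τ (ρ j) (ρ (suc j)) o L

  remaining-suc : ∀ j L → T ∸ j ≡ suc L → T ∸ suc j ≡ L
  remaining-suc j L rem = trans (sym (pred[m∸n]≡m∸[1+n] T j)) (cong pred rem)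

  windowFrom : ∀ j o′ L → T ∸ suc j ≡ L → window τ ρ (suc j) ≡ (suc o′ , o′ + L) → o′ + L ≤ T →
    ρ (suc j) ≡ std (factor τ o′ L) → WindowAt (suc j)
  windowFrom j o′ L refl win fits eq =
    windowData o′ win fits (subst (λ z → SameOrder z (factor τ o′ L)) (sym eq) (std-sameOrder _))

  windowAt : ∀ j → j ≤ n → WindowAt j
  stepAt : ∀ j → j < n → StepAt j

  windowAt zero _ = windowData 0 refl ≤-refl
    (λ e L → cong (λ z → std (factor z e L)) (trans start (sym (take-all T τ ≤-refl))))
  windowAt (suc j) j<n with stepAt j j<n
  ... | stepData o L win rem fits _ (leftCover left eq) =
    windowFrom j (suc o) L (remaining-suc j L rem)
      (trans (window-via τ ρ j win left) (cong (suc (suc o) ,_) (+-suc o L)))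
      (subst (_≤ T) (+-suc o L) fits) eq
  ... | stepData o L win rem fits _ (rightCover right eq) =
    windowFrom j o L (remaining-suc j L rem)
      (trans (window-via τ ρ j win right) (cong (λ k → suc o , k ∸ 1) (+-suc o L)))
      (≤-trans (+-monoʳ-≤ o (n≤1+n L)) fits) eq

  stepAt j j<n with windowAt j (<⇒≤ j<n)
  ... | windowData o win fits same =
    stepData o L (subst (λ k → window τ ρ j ≡ (suc o , o + k)) rem win) rem
      (subst (λ k → o + k ≤ T) rem fits) same′
      (classify-cover τ (ρ j) (ρ (suc j)) o L (trans (size j (<⇒≤ j<n)) rem) (size (suc j) j<n) (cover j j<n) same′)
    where
    L = T ∸ suc j
    rem : T ∸ j ≡ suc L
    rem = +-∸-assoc 1 (<-≤-trans j<n (m∸n≤m T (length σ)))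
    same′ : SameOrder (ρ j) (factor τ o (suc L))
    same′ = subst (λ k → SameOrder (ρ j) (factor τ o k)) rem same

module _ {σ τ : List ℕ} where
  open ChainIds σ τ using (n)

  -- In a maximal chain the length of ρ_k determines k.
  chain-index : ∀ {ρ ρ′} → MaxChain σ τ ρ′ → MaxChain σ τ ρ → ∀ {m k} → m ≤ n → k ≤ n → ρ′ m ≡ ρ k → m ≡ k
  chain-index mc′ mc {m} {k} m≤n k≤n eq =
    ∸-cancelˡ-≡ (≤-trans m≤n (m∸n≤m (length τ) (length σ))) (≤-trans k≤n (m∸n≤m (length τ) (length σ)))
      (trans (sym (MaxChain.size mc′ m m≤n)) (trans (cong length eq) (MaxChain.size mc k k≤n)))

  module _ {ρ : ℕ → List ℕ} (mc : MaxChain σ τ ρ) where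

    interval-index : ∀ {p q k} → q ≤ n → k ≤ n → InInterval ρ p q (ρ k) → p < k × k < q
    interval-index q≤n k≤n (m , p<m , m<q , eq) with chain-index mc mc (≤-trans (<⇒≤ m<q) q≤n) k≤n eq
    ... | refl = p<m , m<q

    outside-interval : ∀ {p q k} → q ≤ n → k ≤ n → k ≤ p ⊎ q ≤ k → ¬ InInterval ρ p q (ρ k)
    outside-interval q≤n k≤n (inj₁ k≤p) inside = <⇒≱ (proj₁ (interval-index q≤n k≤n inside)) k≤p
    outside-interval q≤n k≤n (inj₂ q≤k) inside = <⇒≱ (proj₂ (interval-index q≤n k≤n inside)) q≤k

    agree-outside : ∀ {ρ′ p q} → MaxChain σ τ ρ′ → q ≤ n →
      (∀ k → k ≤ n → ¬ InInterval ρ p q (ρ k) → InChain ρ′ n (ρ k)) →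
      ∀ k → k ≤ n → k ≤ p ⊎ q ≤ k → ρ′ k ≡ ρ k
    agree-outside mc′ q≤n kept k k≤n outside with kept k k≤n (outside-interval q≤n k≤n outside)
    ... | m , m≤n , eq with chain-index mc′ mc m≤n k≤n eq
    ...   | refl = eq

replaceAt : ℕ → List ℕ → (ℕ → List ℕ) → ℕ → List ℕ
replaceAt k Y ρ m with m ≟ k
... | yes _ = Y
... | no _ = ρ m

replaceAt-hit : ∀ k Y ρ → replaceAt k Y ρ k ≡ Y
replaceAt-hit k Y ρ with k ≟ k
... | yes _ = refl
... | no k≢k = contradiction refl k≢k

replaceAt-miss : ∀ k Y ρ m → m ≢ k → replaceAt k Y ρ m ≡ ρ m
replaceAt-miss k Y ρ m m≢k with m ≟ k
... | yes m≡k = contradiction m≡k m≢k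
... | no _ = refl

replaceAt-cases : ∀ k Y ρ m → (m ≡ k × replaceAt k Y ρ m ≡ Y) ⊎ (m ≢ k × replaceAt k Y ρ m ≡ ρ m)
replaceAt-cases k Y ρ m with m ≟ k
... | yes m≡k = inj₁ (m≡k , refl)
... | no m≢k = inj₂ (m≢k , refl)

replace-maxChain : ∀ {σ τ ρ Y} → MaxChain σ τ ρ → ∀ s → suc s < length τ ∸ length σ →
  IsPerm Y → length Y ≡ length τ ∸ suc s → Y ≼ ρ s → ρ (suc (suc s)) ≼ Y →
  MaxChain σ τ (replaceAt (suc s) Y ρ)
replace-maxChain {σ} {τ} {ρ} {Y} mc s s+1<n permY |Y| Y≼ ≼Y = record
  { start = trans (miss 0 (λ ())) start
  ; end   = trans (miss n (λ n≡ → <-irrefl (sym n≡) s+1<n)) end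
  ; perm  = perm′
  ; size  = size′
  ; cover = cover′
  }
  where
  open MaxChain mc
  open ChainIds σ τ using (n)
  ρ′ = replaceAt (suc s) Y ρ
  miss = replaceAt-miss (suc s) Y ρ
  perm′ : ∀ m → m ≤ n → IsPerm (ρ′ m)
  perm′ m m≤n with replaceAt-cases (suc s) Y ρ m
  ... | inj₁ (_ , eq) = subst IsPerm (sym eq) permY
  ... | inj₂ (_ , eq) = subst IsPerm (sym eq) (perm m m≤n)
  size′ : ∀ m → m ≤ n → length (ρ′ m) ≡ length τ ∸ m
  size′ m m≤n with replaceAt-cases (suc s) Y ρ m
  ... | inj₁ (refl , eq) = trans (cong length eq) |Y|
  ... | inj₂ (_ , eq) = trans (cong length eq) (size m m≤n)
  cover′ : ∀ m → m < n → ρ′ (suc m) ≼ ρ′ m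
  cover′ m m<n with replaceAt-cases (suc s) Y ρ m | replaceAt-cases (suc s) Y ρ (suc m)
  ... | inj₁ (refl , eq) | _ = subst₂ _≼_ (sym (miss (suc (suc s)) (λ s≡ → <-irrefl (sym s≡) (n<1+n (suc s))))) (sym eq) ≼Y
  ... | inj₂ _ | inj₁ (refl , eq) = subst₂ _≼_ (sym eq) (sym (miss s (λ s≡ → <-irrefl s≡ (n<1+n s)))) Y≼
  ... | inj₂ (_ , eq) | inj₂ (_ , eq′) = subst₂ _≼_ (sym eq′) (sym eq) (cover m m<n)

run-or-switch : (f : ℕ → Bool) → ∀ p i → p ≤ i → f i ≡ true →
  (∀ s → p ≤ s → s ≤ i → f s ≡ true) ⊎ (Σ ℕ λ s → p ≤ s × s < i × f s ≡ false × f (suc s) ≡ true)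
run-or-switch f p i p≤i fᵢ with m≤n⇒m<n∨m≡n p≤i
... | inj₂ refl = inj₁ λ s p≤s s≤p → subst (λ k → f k ≡ true) (≤-antisym p≤s s≤p) fᵢ
... | inj₁ (s≤s {n = i′} p≤i′) with f i′ in fᵢ′
...   | false = inj₂ (i′ , p≤i′ , ≤-refl , fᵢ′ , fᵢ)
...   | true with run-or-switch f p i′ p≤i′ fᵢ′
...     | inj₂ (s , p≤s , s<i′ , fₛ , fₛ₊₁) = inj₂ (s , p≤s , m≤n⇒m≤1+n s<i′ , fₛ , fₛ₊₁)
...     | inj₁ allTrue = inj₁ λ s p≤s s≤i →
  [ (λ s<i → allTrue s p≤s (≤-pred s<i)) , (λ { refl → fᵢ }) ]′ (m≤n⇒m<n∨m≡n s≤i)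

module OnChain (σ τ : List ℕ) (ρ : ℕ → List ℕ) (mc : MaxChain σ τ ρ) where
  open MaxChain mc
  open ChainIds σ τ
  open WindowInvariant σ τ ρ mc

  label-≤-rightEnd : ∀ j → j < n → label τ ρ j ≤ proj₂ (window τ ρ j)
  label-≤-rightEnd j j<n with stepAt j j<n
  ... | stepData o L win _ _ _ (leftCover left _) rewrite label-via τ ρ j win left | win =
    subst (suc o ≤_) (sym (+-suc o L)) (s≤s (m≤m+n o L))
  ... | stepData o L win _ _ _ (rightCover right _) rewrite label-via τ ρ j win right | win = ≤-refl

  -- A right step removes the right end b, and all later labels are < b: so the step
  -- before an ascent is a left step.
  ascent⇒left : ∀ j → suc j < n → label τ ρ j < label τ ρ (suc j) → isLeft τ ρ j ≡ true
  ascent⇒left j j+1<n ascent with stepAt j (<-trans (n<1+n j) j+1<n)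
  ... | stepData o L win _ _ _ (leftCover left _) = isLeft-via τ ρ j win left
  ... | stepData o L win _ _ _ (rightCover right _) = contradiction ascent (≤⇒≯ (begin
    label τ ρ (suc j)           ≤⟨ label-≤-rightEnd (suc j) j+1<n ⟩
    proj₂ (window τ ρ (suc j))  ≡⟨ cong proj₂ (window-via τ ρ j win right) ⟩
    o + suc L ∸ 1               ≤⟨ m∸n≤m (o + suc L) 1 ⟩
    o + suc L                   ≡⟨ label-via τ ρ j win right ⟨
    label τ ρ j                 ∎))
    where open ≤-Reasoning

  EarlierVariant : ℕ → Set
  EarlierVariant k = Σ (ℕ → List ℕ) λ ρ′ → MaxChain σ τ ρ′ × LexLt (chainId σ τ ρ′) (chainId σ τ ρ) ×
    (∀ m → m ≢ k → ρ′ m ≡ ρ m)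

  -- Step s removes the right end o+L+1 of the window (o+1, o+L+1) and step s+1 its left
  -- end.  Removing the left end first gives an earlier chain: its label at s is o+1.
  swap-core : ∀ s o L₂ → suc s < n → IsPerm τ →
    window τ ρ s ≡ (suc o , o + suc (suc L₂)) →
    T ∸ s ≡ suc (suc L₂) → o + suc (suc L₂) ≤ T → SameOrder (ρ s) (factor τ o (suc (suc L₂))) →
    label τ ρ s ≡ o + suc (suc L₂) →
    ρ (suc (suc s)) ≡ std (factor τ (suc o) L₂) → EarlierVariant (suc s)
  swap-core s o L₂ s+1<n permτ win rem fits same labelRight eq₂ = ρ′ , chain′ , earlier , miss
    where
    L = suc L₂
    s<n = <-trans (n<1+n s) s+1<n
    fits′ : suc o + L ≤ T
    fits′ = subst (_≤ T) (+-suc o L) fits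
    Y = std (factor τ (suc o) L)
    ρ′ = replaceAt (suc s) Y ρ
    miss = replaceAt-miss (suc s) Y ρ
    chain′ : MaxChain σ τ ρ′
    chain′ = replace-maxChain mc s s+1<n (factor-isPerm τ (suc o) L permτ fits′ (s≤s z≤n))
      (trans (length-std-factor τ (suc o) L fits′) (sym (remaining-suc s L rem)))
      (dropFirst-≼ τ (ρ s) o L (trans (size s (<⇒≤ s<n)) rem) fits same)
      (subst (_≼ Y) (sym eq₂) (prefix-≼ τ (suc o) L L₂ (n≤1+n L₂) fits′))
    agree : AgreeUpTo s ρ′ ρ
    agree m m≤s = miss m (λ m≡ → <-irrefl m≡ (s≤s m≤s))
    labelLeft : label τ ρ′ s ≡ suc o
    labelLeft = label-via τ ρ′ s (trans (window-ext τ agree s ≤-refl) win)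
      (leftStep-slice τ (suc o) (o + suc L) (ρ′ s)
        (trans (cong std (slice-factor τ o L)) (sym (replaceAt-hit (suc s) Y ρ))))
    earlier : LexLt (chainId σ τ ρ′) (chainId σ τ ρ)
    earlier = earlier-at s<n agree (subst₂ _<_ (sym labelLeft) (sym labelRight)
      (subst (suc o <_) (sym (+-suc o L)) (s≤s (m<m+n o z<s))))

  rightLeft-swap : ∀ s → suc s < n → IsPerm τ → isLeft τ ρ s ≡ false → isLeft τ ρ (suc s) ≡ true →
    EarlierVariant (suc s)
  rightLeft-swap s s+1<n permτ isRight isLeft′
    with stepAt s (<-trans (n<1+n s) s+1<n) | stepAt (suc s) s+1<n
  ... | stepData _ _ win _ _ _ (leftCover left _) | _ =
    contradiction (trans (sym (isLeft-via τ ρ s win left)) isRight) λ ()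
  ... | _ | stepData _ _ win₂ _ _ _ (rightCover right₂ _) =
    contradiction (trans (sym (isLeft-via τ ρ (suc s) win₂ right₂)) isLeft′) λ ()
  ... | stepData o L win rem fits same (rightCover right _) | stepData o₂ L₂ win₂ rem₂ _ _ (leftCover _ eq₂)
    with suc-injective (cong proj₁ (trans (sym win₂) (window-via τ ρ s win right)))
       | trans (sym (remaining-suc s L rem)) rem₂
  ...  | refl | refl = swap-core s o L₂ s+1<n permτ win rem fits same (label-via τ ρ s win right) eq₂

  -- Every ρ_{j+1} is nonempty, so step j removes from a window of length ≥ 2.
  remaining-positive : ∀ j → j < n → 1 ≤ T ∸ suc j
  remaining-positive j j<n = subst (1 ≤_) (size (suc j) j<n) (proj₁ (perm (suc j) j<n))

  -- An earlier chain agreeing with ρ up to ρ_m must follow a left step of ρ at m: a right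
  -- step would give it the larger label at the first difference.
  left-forced : ∀ {ρ′} m → m < n → MaxChain σ τ ρ′ → LexLt (chainId σ τ ρ′) (chainId σ τ ρ) →
    AgreeUpTo m ρ′ ρ → isLeft τ ρ m ≡ true → ρ′ (suc m) ≡ ρ (suc m)
  left-forced {ρ′} m m<n mc′ earlier agree isLeftₘ
    with stepAt m m<n | WindowInvariant.stepAt σ τ ρ′ mc′ m m<n
  ... | stepData _ _ win _ _ _ (rightCover right _) | _ =
    contradiction (trans (sym (isLeft-via τ ρ m win right)) isLeftₘ) λ ()
  ... | stepData o L win rem _ _ (leftCover left eq) | stepData o′ L′ win′ rem′ _ _ step′
    with suc-injective (cong proj₁ (trans (sym win′) (trans (window-ext τ agree m ≤-refl) win)))
       | suc-injective (trans (sym rem′) rem)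
  ... | refl | refl with step′
  ...   | leftCover _ eq′ = trans eq′ (sym eq)
  ...   | rightCover right′ _ = contradiction earlier (not-earlier-at m<n agree
    (subst₂ _<_ (sym (label-via τ ρ m win left)) (sym (label-via τ ρ′ m win′ right′))
      (subst (suc o <_) (sym (+-suc o L)) (s≤s (subst (_≤ o + L) (+-comm o 1) (+-monoʳ-≤ o L≥1))))))
    where
    L≥1 : 1 ≤ L
    L≥1 = subst (1 ≤_) (remaining-suc m L rem) (remaining-positive m m<n)

  agree-extend : ∀ {ρ′ m} → AgreeUpTo m ρ′ ρ → ρ′ (suc m) ≡ ρ (suc m) → AgreeUpTo (suc m) ρ′ ρ
  agree-extend agree next k k≤m+1 with m≤n⇒m<n∨m≡n k≤m+1
  ... | inj₁ k<m+1 = agree k (≤-pred k<m+1)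
  ... | inj₂ refl = next

  left-run-agree : ∀ {ρ′} p i → p ≤ i → i < n → MaxChain σ τ ρ′ → LexLt (chainId σ τ ρ′) (chainId σ τ ρ) →
    AgreeUpTo p ρ′ ρ → (∀ s → p ≤ s → s ≤ i → isLeft τ ρ s ≡ true) → AgreeUpTo (suc i) ρ′ ρ
  left-run-agree {ρ′} p i p≤i i<n mc′ earlier agreeₚ allLeft =
    agree-extend upToI (left-forced i i<n mc′ earlier upToI (allLeft i p≤i ≤-refl))
    where
    upToI : AgreeUpTo i ρ′ ρ
    upToI with m≤n⇒m<n∨m≡n p≤i
    ... | inj₂ refl = agreeₚ
    ... | inj₁ (s≤s p≤i′) = left-run-agree p _ p≤i′ (<-trans (n<1+n _) i<n) mc′ earlier agreeₚ
      (λ s p≤s s≤i′ → allLeft s p≤s (m≤n⇒m≤1+n s≤i′))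

  skipped-from-variant : ∀ p i s → p ≤ s → suc s < i → i ≤ n → EarlierVariant (suc s) → Skipped σ τ ρ p i
  skipped-from-variant p i s p≤s s+1<i i≤n (ρ′ , mc′ , earlier , miss) =
    ≤-<-trans p≤s (<-trans (n<1+n s) s+1<i) , i≤n , (ρ (suc s) , inside) , ρ′ , mc′ , earlier ,
    λ k k≤n notInside → k , k≤n , miss k (λ k≡ → notInside (subst (λ m → InInterval ρ p i (ρ m)) (sym k≡) inside))
    where
    inside : InInterval ρ p i (ρ (suc s))
    inside = suc s , s≤s p≤s , s+1<i , refl

  -- If C(ρ_p,ρ_q) is skipped and steps p, …, i′ are left, the witnessing chain already
  -- agrees with ρ up to ρ_{i′+1}, so C(ρ_{i′+1},ρ_q) is skipped too; it is nonempty, as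
  -- otherwise the witness would coincide with ρ.
  skipped-after-left-run : ∀ p i′ q → p ≤ i′ → suc i′ < q → Skipped σ τ ρ p q →
    (∀ s → p ≤ s → s ≤ i′ → isLeft τ ρ s ≡ true) → Skipped σ τ ρ (suc i′) q
  skipped-after-left-run p i′ q p≤i′ i′+1<q (_ , q≤n , _ , ρ′ , mc′ , earlier , kept) allLeft =
    i′+1<q , q≤n , witness (m≤n⇒m<n∨m≡n i′+1<q) , ρ′ , mc′ , earlier ,
    λ k k≤n notInside → k , k≤n , agree-off k k≤n notInside
    where
    i′<n : i′ < n
    i′<n = <-≤-trans (<-trans (n<1+n i′) i′+1<q) q≤n
    outside = agree-outside mc mc′ q≤n kept
    agreeLow : AgreeUpTo (suc i′) ρ′ ρ
    agreeLow = left-run-agree p i′ p≤i′ i′<n mc′ earlier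
      (λ k k≤p → outside k (≤-trans k≤p (≤-trans p≤i′ (<⇒≤ i′<n))) (inj₁ k≤p)) allLeft
    agree-off : ∀ k → k ≤ n → ¬ InInterval ρ (suc i′) q (ρ k) → ρ′ k ≡ ρ k
    agree-off k k≤n notInside with k ≤? suc i′ | q ≤? k
    ... | yes k≤i′+1 | _ = agreeLow k k≤i′+1
    ... | no _ | yes q≤k = outside k k≤n (inj₂ q≤k)
    ... | no k≰ | no q≰ = contradiction (k , ≰⇒> k≰ , ≰⇒> q≰ , refl) notInside
    witness : suc (suc i′) < q ⊎ suc (suc i′) ≡ q → Σ (List ℕ) (InInterval ρ (suc i′) q)
    witness (inj₁ i′+2<q) = ρ (suc (suc i′)) , suc (suc i′) , ≤-refl , i′+2<q , refl
    witness (inj₂ refl) = contradiction (subst (λ c → LexLt c (chainId σ τ ρ)) (chainId-ext agreeAll) earlier) lex-irrefl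
      where
      agreeAll : AgreeUpTo n ρ′ ρ
      agreeAll k k≤n = agree-off k k≤n λ { (m , i′+1<m , m<i′+2 , _) → <-irrefl refl (<-≤-trans i′+1<m (≤-pred m<i′+2)) }

  msi-minimal : ∀ {p q p′ q′ k} → MSI σ τ ρ p q → Skipped σ τ ρ p′ q′ → p ≤ p′ → q′ ≤ q →
    k ≤ n → p < k → k < q → k ≤ p′ ⊎ q′ ≤ k → ⊥
  msi-minimal {p} {q} {p′} {q′} {k} (_ , minimal) skipped p≤p′ q′≤q k≤n p<k k<q outside =
    minimal p′ q′ skipped shrink (ρ k , (k , p<k , k<q , refl) , outside-interval mc (proj₁ (proj₂ skipped)) k≤n outside)
    where
    shrink : ∀ x → InInterval ρ p′ q′ x → InInterval ρ p q x
    shrink x (m , p′<m , m<q′ , eq) = m , ≤-<-trans p≤p′ p′<m , <-≤-trans m<q′ q′≤q , eq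

  ascent-outside-msi : IsPerm τ → ∀ i′ → suc i′ < n → isLeft τ ρ i′ ≡ true →
    ∀ p q → MSI σ τ ρ p q → ¬ InInterval ρ p q (ρ (suc i′))
  ascent-outside-msi permτ i′ i<n leftBefore p q msi inside
    with interval-index mc (proj₁ (proj₂ (proj₁ msi))) (<⇒≤ i<n) inside
  ... | p<i , i<q with run-or-switch (isLeft τ ρ) p i′ (≤-pred p<i) leftBefore
  ...   | inj₁ allLeft = msi-minimal msi
    (skipped-after-left-run p i′ q (≤-pred p<i) i<q (proj₁ msi) allLeft)
    (<⇒≤ p<i) ≤-refl (<⇒≤ i<n) p<i i<q (inj₁ ≤-refl)
  ...   | inj₂ (s , p≤s , s<i′ , right , left) = msi-minimal msi
    (skipped-from-variant p (suc i′) s p≤s (s≤s s<i′) (<⇒≤ i<n)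
      (rightLeft-swap s (<-trans (s≤s s<i′) i<n) permτ right left))
    ≤-refl (<⇒≤ i<q) (<⇒≤ i<n) p<i i<q (inj₂ ≤-refl)

below-pred : ∀ i n → suc i ≤ n ∸ 1 → suc i < n
below-pred i (suc n) i<n = s≤s i<n

-- Lemma 2.3.  The ascent l_i < l_{i+1} is the ascent label i-1 < label i, so step i-1
-- is a left step and ascent-outside-msi applies.
lemma2p3 : (σ τ : List ℕ) → IsPerm σ → IsPerm τ → σ ≼ τ →
    (ρ : ℕ → List ℕ) → MaxChain σ τ ρ →
    (i : ℕ) → 1 ≤ i → i ≤ (length τ ∸ length σ) ∸ 1 →
    nth (chainId σ τ ρ) (i ∸ 1) < nth (chainId σ τ ρ) i →
    (a b : ℕ) → MSI σ τ ρ a b → ¬ InInterval ρ a b (ρ i)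
lemma2p3 σ τ _ permτ _ ρ mc (suc i′) _ i≤n∸1 ascent =
  ascent-outside-msi permτ i′ i<n (ascent⇒left i′ i<n labelAscent)
  where
  open ChainIds σ τ
  open OnChain σ τ ρ mc
  i<n : suc i′ < n
  i<n = below-pred i′ n i≤n∸1
  labelAscent : label τ ρ i′ < label τ ρ (suc i′)
  labelAscent = subst₂ _<_ (nth-chainId ρ i′ (<-trans (n<1+n i′) i<n)) (nth-chainId ρ (suc i′) i<n) ascent
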